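{- Let $(\mathbf K,\sigma,\gamma)$ be a lower-compatible triple. Then there is an integral residuated lattice $\mathbf B$ with universe $(K\setminus\{1\})\cup\{f,1\}$ (with $f\notin K$), whose operations extend those of $(\mathbf K\setminus\{1\})$ and of the two-element IRL $\mathbf G=\{f<1\}$, such that $G=\{f,1\}$ is a congruence filter of $\mathbf B$ compatible with $\mathbf B$, and the compatible triple of the pair $(\mathbf B,G)$ is $(\mathbf K,\sigma,\gamma)$.
   Context: An IRL is a residuated lattice with $1$ as top. A congruence filter of an IRL is a nonempty upset closed under products and conjugates; $[x]_F$ denotes classes of $\theta_F=\{(x,y):x\backslash y,y\backslash x\in F\}$. $F$ is compatible with $\mathbf B$ if elements of $F$ are strictly above those of $B\setminus F$; each $[b]_F$ ($b\in B\setminus F$) has minimum $\sigma_F(b)$ and maximum $\gamma_F(b)$ (with $\sigma_F(1)=\gamma_F(1)=1$); and $b\sigma_F[B\setminus F],\ \sigma_F[B\setminus F]b\subseteq\sigma_F[B\setminus F]$ for $b\in B\setminus F$. The compatible triple of such a pair $(\mathbf B,F)$ is $(\mathbf B',\sigma_F,\gamma_F)$, where $\mathbf B'$ is the partial algebra on $(B\setminus F)\cup\{1\}$ with inherited operations, joins landing in $F\setminus\{1\}$ redefined as $1$, and divisions landing in $F\setminus\{1\}$ undefined. A partial IRL is a partially ordered partial algebra in the residuated lattice language, integral ($x\le 1$), where joins/meets are least upper/greatest lower bounds when defined, $1$ is a unit, products are associative when all are defined, residuation holds whenever the terms are defined, multiplication is order preserving, and divisions are order preserving in numerator and reversing in denominator,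 when defined. A lower-compatible triple $(\mathbf K,\sigma,\gamma)$ is a partial IRL $\mathbf K$ with all operations defined except $x\backslash y$, $y/x$, which are undefined exactly when $\sigma(x)\le y$ and $x\not\le y$, together with maps with $\sigma(x)\le y\iff x\le\gamma(y)$, where $\sigma$ is an interior operator with $\sigma(1)=1$ and $x\sigma(y)=\sigma(xy)=\sigma(x)y$ for $x,y\ne1$, $\gamma$ is a closure operator, and $xy,yx\le\sigma(x)$ whenever $y\ne1$. -}

module Defs where

open import Level using (Level; _⊔_) renaming (suc to lsuc)
open import Data.Empty using (⊥)
open import Data.Unit using (⊤; tt)
open import Data.Sum using (_⊎_; inj₁; inj₂)
open import Data.Product using (Σ; _×_; _,_; proj₁; proj₂)
open import Data.Maybe using (Maybe; just; nothing)
open import Relation.Nullary using (¬_)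
open import Relation.Binary.PropositionalEquality using (_≡_; _≢_)
open import Relation.Binary.Structures using (IsPartialOrder)
open import Function.Bundles using (_⇔_)
open import Algebra.Core using (Op₂)
open import Algebra.Structures using (IsMonoid)
open import Algebra.Lattice.Structures using (IsLattice)

private variable ℓ : Level

record IRLOn (A : Set ℓ) : Set ℓ where
  infixl 7 _·_
  infixr 6 _∧_
  infixr 5 _∨_
  field
    _∧_ _∨_ _·_ _\\_ _//_ : Op₂ A
    one : A
  _≤_ : A → A → Set ℓ
  x ≤ y = (x ∧ y) ≡ x
  field
    isLattice : IsLattice _≡_ _∨_ _∧_
    isMonoid  : IsMonoid _≡_ _·_ one
    resˡ      : ∀ x y z → ((x · y) ≤ z) ⇔ (y ≤ (x \\ z))
    resʳ      : ∀ x y z → ((x · y) ≤ z) ⇔ (x ≤ (z // y))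
    integral  : ∀ x → x ≤ one

module _ {A : Set ℓ} (B : IRLOn A) where
  open IRLOn B

  θ : (A → Set ℓ) → A → A → Set ℓ
  θ F x y = F (x \\ y) × F (y \\ x)

  record IsCongruenceFilter (F : A → Set ℓ) : Set ℓ where
    field
      nonempty  : Σ A F
      upset     : ∀ {x y} → F x → x ≤ y → F y
      prod      : ∀ {x y} → F x → F y → F (x · y)
      conjˡ     : ∀ {x} y → F x → F ((y \\ (x · y)) ∧ one)
      conjʳ     : ∀ {x} y → F x → F (((y · x) // y) ∧ one)

  IsMinOfClass : (A → Set ℓ) → A → A → Set ℓ
  IsMinOfClass F b m = θ F m b × (∀ x → θ F x b → m ≤ x)

  IsMaxOfClass : (A → Set ℓ) → A → A → Set ℓ
  IsMaxOfClass F b m = θ F m b × (∀ x → θ F x b → x ≤ m)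

  record Compatible (F : A → Set ℓ) : Set ℓ where
    field
      strictlyAbove : ∀ {x y} → F x → ¬ F y → (y ≤ x) × (y ≢ x)
      minClass : ∀ b → ¬ F b → Σ A (IsMinOfClass F b)
      maxClass : ∀ b → ¬ F b → Σ A (IsMaxOfClass F b)
    σF : ∀ b → ¬ F b → A
    σF b nb = proj₁ (minClass b nb)
    γF : ∀ b → ¬ F b → A
    γF b nb = proj₁ (maxClass b nb)
    field
      closedˡ : ∀ b (nb : ¬ F b) c (nc : ¬ F c) →
                Σ A λ d → Σ (¬ F d) λ nd → (b · σF c nc) ≡ σF d nd
      closedʳ : ∀ b (nb : ¬ F b) c (nc : ¬ F c) →
                Σ A λ d → Σ (¬ F d) λ nd → (σF c nc · b) ≡ σF d nd

record LowerCompatibleTriple ℓ : Set (lsuc ℓ) where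
  infixl 7 _·_
  field
    K : Set ℓ
    _≤_ : K → K → Set ℓ
    _∧_ _∨_ _·_ : K → K → K
    _\\_ _//_ : K → K → Maybe K
    one : K
    σ γ : K → K
    isPartialOrder : IsPartialOrder _≡_ _≤_
    integral : ∀ x → x ≤ one
    ∨-upperˡ : ∀ x y → x ≤ (x ∨ y)
    ∨-upperʳ : ∀ x y → y ≤ (x ∨ y)
    ∨-least  : ∀ {x y z} → x ≤ z → y ≤ z → (x ∨ y) ≤ z
    ∧-lowerˡ : ∀ x y → (x ∧ y) ≤ x
    ∧-lowerʳ : ∀ x y → (x ∧ y) ≤ y
    ∧-greatest : ∀ {x y z} → z ≤ x → z ≤ y → z ≤ (x ∧ y)
    identityˡ : ∀ x → (one · x) ≡ x
    identityʳ : ∀ x → (x · one) ≡ x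
    assoc : ∀ x y z → ((x · y) · z) ≡ (x · (y · z))
    resˡ : ∀ x y z w → (x \\ z) ≡ just w → ((x · y) ≤ z) ⇔ (y ≤ w)
    resʳ : ∀ x y z w → (z // y) ≡ just w → ((x · y) ≤ z) ⇔ (x ≤ w)
    ·-monoˡ : ∀ {x y} z → x ≤ y → (x · z) ≤ (y · z)
    ·-monoʳ : ∀ {x y} z → x ≤ y → (z · x) ≤ (z · y)
    \\-mono-num : ∀ {x y y' w w'} → y ≤ y' →
                  (x \\ y) ≡ just w → (x \\ y') ≡ just w' → w ≤ w'
    \\-anti-den : ∀ {x x' y w w'} → x' ≤ x →
                  (x \\ y) ≡ just w → (x' \\ y) ≡ just w' → w ≤ w'
    //-mono-num : ∀ {x y y' w w'} → y ≤ y' →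
                  (y // x) ≡ just w → (y' // x) ≡ just w' → w ≤ w'
    //-anti-den : ∀ {x x' y w w'} → x' ≤ x →
                  (y // x) ≡ just w → (y // x') ≡ just w' → w ≤ w'
    \\-undef : ∀ x y → ((x \\ y) ≡ nothing) ⇔ ((σ x ≤ y) × ¬ (x ≤ y))
    //-undef : ∀ x y → ((y // x) ≡ nothing) ⇔ ((σ x ≤ y) × ¬ (x ≤ y))
    galois : ∀ x y → (σ x ≤ y) ⇔ (x ≤ γ y)
    σ-deflationary : ∀ x → σ x ≤ x
    σ-mono : ∀ {x y} → x ≤ y → σ x ≤ σ y
    σ-idem : ∀ x → σ (σ x) ≡ σ x
    σ-one : σ one ≡ one
    σ-linear : ∀ x y → x ≢ one → y ≢ one →
               ((x · σ y) ≡ σ (x · y)) × (σ (x · y) ≡ (σ x · y))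
    γ-inflationary : ∀ x → x ≤ γ x
    γ-mono : ∀ {x y} → x ≤ y → γ x ≤ γ y
    γ-idem : ∀ x → γ (γ x) ≡ γ x
    absorb : ∀ x y → y ≢ one → ((x · y) ≤ σ x) × ((y · x) ≤ σ x)

data Two : Set where
  f₀ 1₀ : Two

_∧G_ : Two → Two → Two
1₀ ∧G y = y
f₀ ∧G y = f₀

_∨G_ : Two → Two → Two
1₀ ∨G y = 1₀
f₀ ∨G y = y

_·G_ : Two → Two → Two
_·G_ = _∧G_

_\\G_ : Two → Two → Two
f₀ \\G y = 1₀
1₀ \\G y = y

_//G_ : Two → Two → Two
y //G x = x \\G y

-- Statement-specific notions, for an IRL on (K ∖ {1}) ∪ {f, 1} = K ⊎ ⊤
-- with f = inj₂ tt and 1 = inj₁ one.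

module _ (T : LowerCompatibleTriple ℓ) where
  open LowerCompatibleTriple T

  Bcar : Set ℓ
  Bcar = K ⊎ ⊤

  fB : Bcar
  fB = inj₂ tt

  Gset : Bcar → Set ℓ
  Gset x = (x ≡ fB) ⊎ (x ≡ inj₁ one)

  embG : Two → Bcar
  embG f₀ = fB
  embG 1₀ = inj₁ one

  module _ (B : IRLOn Bcar) where
    private module B = IRLOn B

    ExtendsKminus1 : Set ℓ
    ExtendsKminus1 = ∀ x y → x ≢ one → y ≢ one →
        (inj₁ (x ∧ y) ≡ (inj₁ x B.∧ inj₁ y))
      × (inj₁ (x · y) ≡ (inj₁ x B.· inj₁ y))
      × ((x ∨ y) ≢ one → inj₁ (x ∨ y) ≡ (inj₁ x B.∨ inj₁ y))
      × (∀ z → (x \\ y) ≡ just z → z ≢ one → inj₁ z ≡ (inj₁ x B.\\ inj₁ y))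
      × (∀ z → (y // x) ≡ just z → z ≢ one → inj₁ z ≡ (inj₁ y B.// inj₁ x))

    ExtendsG : Set ℓ
    ExtendsG = ∀ a b →
        (embG (a ∧G b) ≡ (embG a B.∧ embG b))
      × (embG (a ∨G b) ≡ (embG a B.∨ embG b))
      × (embG (a ·G b) ≡ (embG a B.· embG b))
      × (embG (a \\G b) ≡ (embG a B.\\ embG b))
      × (embG (b //G a) ≡ (embG b B.// embG a))

    -- the compatible triple of (B, G) is (K, σ, γ), the universe
    -- (B ∖ G) ∪ {1} of the compatible triple being identified with K via inj₁
    CompatibleTripleIs : Compatible B Gset → Set ℓ
    CompatibleTripleIs c =
        (B.one ≡ inj₁ one)
      × (∀ x y → (x ≤ y) ⇔ (inj₁ x B.≤ inj₁ y))
      × (∀ x y → inj₁ (x ∧ y) ≡ (inj₁ x B.∧ inj₁ y))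
      × (∀ x y → inj₁ (x · y) ≡ (inj₁ x B.· inj₁ y))
      × (∀ x y → (Gset (inj₁ x B.∨ inj₁ y) × (inj₁ x B.∨ inj₁ y) ≢ inj₁ one
                    → (x ∨ y) ≡ one)
               × (¬ (Gset (inj₁ x B.∨ inj₁ y) × (inj₁ x B.∨ inj₁ y) ≢ inj₁ one)
                    → inj₁ (x ∨ y) ≡ (inj₁ x B.∨ inj₁ y)))
      × (∀ x y → (((x \\ y) ≡ nothing) ⇔
                    (Gset (inj₁ x B.\\ inj₁ y) × (inj₁ x B.\\ inj₁ y) ≢ inj₁ one))
               × (∀ z → (x \\ y) ≡ just z → inj₁ z ≡ (inj₁ x B.\\ inj₁ y)))
      × (∀ x y → (((y // x) ≡ nothing) ⇔
                    (Gset (inj₁ y B.// inj₁ x) × (inj₁ y B.// inj₁ x) ≢ inj₁ one))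
               × (∀ z → (y // x) ≡ just z → inj₁ z ≡ (inj₁ y B.// inj₁ x)))
        -- σ_G = σ and γ_G = γ on B ∖ G (on 1 both are 1 by convention)
      × (∀ x (nx : ¬ Gset (inj₁ x)) →
           (Compatible.σF c (inj₁ x) nx ≡ inj₁ (σ x))
         × (Compatible.γF c (inj₁ x) nx ≡ inj₁ (γ x)))
      × (σ one ≡ one) × (γ one ≡ one)

{-# OPTIONS --safe #-}
module Submission where

-- B is K with its top split into f < 1: f lies just below 1 and above every other
-- element of K. Multiplying by f applies σ (f·x = x·f = σ x for x ≠ 1), f\z = z/f = γ z,
-- and the divisions left undefined in K are exactly those whose value in B is f.
-- The residuation laws then reduce to the axioms of the triple: where x\z is
-- undefined, σ x ≤ z while x·y ≤ σ x for y ≠ 1; and f·y ≤ z ⇔ σ y ≤ z ⇔ y ≤ γ z.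
-- G = {f, 1} is the set of elements above f, a congruence filter because f is
-- central; for x, y ∈ K, x θ_G y iff σ x ≤ y and σ y ≤ x, so the class of b has
-- least element σ b and greatest element γ b. Equality with 1 is decided classically.

open import Defs
open import Data.Empty using (⊥-elim)
open import Data.Maybe using (Maybe; just; nothing)
open import Data.Product using (Σ; _×_; _,_; proj₁; proj₂)
open import Data.Sum using (_⊎_; inj₁; inj₂)
open import Data.Unit using (tt)
open import Function.Base using (_∘_)
open import Function.Bundles using (_⇔_; mk⇔; Equivalence)
open import Function.Construct.Identity using (⇔-id)
open import Function.Construct.Symmetry using (⇔-sym)
open import Function.Construct.Composition using (_⇔-∘_)
open import Function.Related.Propositional using (module EquationalReasoning)
open import Relation.Nullary using (¬_; Dec; yes; no)
open import Relation.Binary.PropositionalEquality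
  using (_≡_; _≢_; refl; sym; trans; cong; cong₂; subst; isEquivalence)
open import Relation.Binary.Structures using (IsPartialOrder)
open import Relation.Binary.Lattice using (Lattice; Supremum; Infimum)
open import Relation.Binary.Lattice.Properties.Lattice using (isAlgLattice)
open import Algebra.Core using (Op₂)
open import Algebra.Structures using (IsMonoid)
open import Axiom.ExcludedMiddle using (ExcludedMiddle)

open Equivalence using (to; from)

module ResiduatedPoset
  {ℓ} {A : Set ℓ} {_⊑_ : A → A → Set ℓ} (isPartialOrder : IsPartialOrder _≡_ _⊑_)
  {_⊔_ _⊓_ _⊗_ _⇒_ _⇐_ : Op₂ A} {e : A}
  (supremum : Supremum _⊑_ _⊔_) (infimum : Infimum _⊑_ _⊓_)
  (isMonoid : IsMonoid _≡_ _⊗_ e)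
  (⇒-residual : ∀ a b c → ((a ⊗ b) ⊑ c) ⇔ (b ⊑ (a ⇒ c)))
  (⇐-residual : ∀ a b c → ((a ⊗ b) ⊑ c) ⇔ (a ⊑ (c ⇐ b)))
  (e-top : ∀ a → a ⊑ e)
  where

  private module ⊑ = IsPartialOrder isPartialOrder

  a⊑b⇒a⊓b≡a : ∀ {a b} → a ⊑ b → (a ⊓ b) ≡ a
  a⊑b⇒a⊓b≡a {a} {b} a⊑b =
    ⊑.antisym (proj₁ (infimum a b)) (proj₂ (proj₂ (infimum a b)) a ⊑.refl a⊑b)

  a⊓b≡a⇒a⊑b : ∀ {a b} → (a ⊓ b) ≡ a → a ⊑ b
  a⊓b≡a⇒a⊑b {a} {b} eq = subst (_⊑ b) eq (proj₁ (proj₂ (infimum a b)))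

  private
    via-meet : ∀ {a b c d} → (a ⊑ b) ⇔ (c ⊑ d) → ((a ⊓ b) ≡ a) ⇔ ((c ⊓ d) ≡ c)
    via-meet p = mk⇔ (a⊑b⇒a⊓b≡a ∘ to p ∘ a⊓b≡a⇒a⊑b) (a⊑b⇒a⊓b≡a ∘ from p ∘ a⊓b≡a⇒a⊑b)

  lattice : Lattice ℓ ℓ ℓ
  lattice = record
    { _≈_ = _≡_ ; _≤_ = _⊑_ ; _∨_ = _⊔_ ; _∧_ = _⊓_
    ; isLattice = record
      { isPartialOrder = isPartialOrder ; supremum = supremum ; infimum = infimum } }

  irl : IRLOn A
  irl = record
    { _∧_ = _⊓_ ; _∨_ = _⊔_ ; _·_ = _⊗_ ; _\\_ = _⇒_ ; _//_ = _⇐_ ; one = e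
    ; isLattice = isAlgLattice lattice
    ; isMonoid = isMonoid
    ; resˡ = λ a b c → via-meet (⇒-residual a b c)
    ; resʳ = λ a b c → via-meet (⇐-residual a b c)
    ; integral = λ a → a⊑b⇒a⊓b≡a (e-top a) }

  ⊗-monoʳ : ∀ {a b} c → a ⊑ b → (c ⊗ a) ⊑ (c ⊗ b)
  ⊗-monoʳ {a} {b} c a⊑b =
    from (⇒-residual c a (c ⊗ b)) (⊑.trans a⊑b (to (⇒-residual c b (c ⊗ b)) ⊑.refl))

  ⊗-monoˡ : ∀ {a b} c → a ⊑ b → (a ⊗ c) ⊑ (b ⊗ c)
  ⊗-monoˡ {a} {b} c a⊑b =
    from (⇐-residual a c (b ⊗ c)) (⊑.trans a⊑b (to (⇐-residual b c (b ⊗ c)) ⊑.refl))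

module LowerCompatibleTripleProperties {ℓ} (T : LowerCompatibleTriple ℓ) where
  open LowerCompatibleTriple T
  private module ≤ = IsPartialOrder isPartialOrder

  one≤⇒≡one : ∀ {x} → one ≤ x → x ≡ one
  one≤⇒≡one {x} = ≤.antisym (integral x)

  ≤-≡one : ∀ {x y} → y ≡ one → x ≤ y
  ≤-≡one {x} refl = integral x

  ≡one-≤⇒≡one : ∀ {x y} → x ≡ one → x ≤ y → y ≡ one
  ≡one-≤⇒≡one refl = one≤⇒≡one

  x·y≤x : ∀ x y → (x · y) ≤ x
  x·y≤x x y = subst ((x · y) ≤_) (identityʳ x) (·-monoʳ x (integral y))

  x·y≤y : ∀ x y → (x · y) ≤ y
  x·y≤y x y = subst ((x · y) ≤_) (identityˡ y) (·-monoˡ y (integral x))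

  x·y≡one⇒x≡one : ∀ {x y} → (x · y) ≡ one → x ≡ one
  x·y≡one⇒x≡one {x} {y} eq = ≡one-≤⇒≡one eq (x·y≤x x y)

  x·y≡one⇒y≡one : ∀ {x y} → (x · y) ≡ one → y ≡ one
  x·y≡one⇒y≡one {x} {y} eq = ≡one-≤⇒≡one eq (x·y≤y x y)

  σ-≢one : ∀ {x} → x ≢ one → σ x ≢ one
  σ-≢one {x} x≢one σx≡one = x≢one (≡one-≤⇒≡one σx≡one (σ-deflationary x))

  γ-one : γ one ≡ one
  γ-one = one≤⇒≡one (γ-inflationary one)

  γ≡one⇔≡one : ∀ {z} → (γ z ≡ one) ⇔ (z ≡ one)
  γ≡one⇔≡one {z} = mk⇔
    (λ γz≡one → one≤⇒≡one (subst (_≤ z) σ-one (from (galois one z) (≤-≡one γz≡one))))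
    (λ { refl → γ-one })

  \\-undefined : ∀ {x y z} → (x \\ z) ≡ nothing → ((x · y) ≤ z) ⇔ (y ≢ one)
  \\-undefined {x} {y} {z} eq = mk⇔
    (λ { xy≤z refl → x≰z (subst (_≤ z) (identityʳ x) xy≤z) })
    (λ y≢one → ≤.trans (proj₁ (absorb x y y≢one)) σx≤z)
    where
    σx≤z : σ x ≤ z
    σx≤z = proj₁ (to (\\-undef x z) eq)
    x≰z : ¬ x ≤ z
    x≰z = proj₂ (to (\\-undef x z) eq)

  //-undefined : ∀ {x y z} → (z // y) ≡ nothing → ((x · y) ≤ z) ⇔ (x ≢ one)
  //-undefined {x} {y} {z} eq = mk⇔
    (λ { xy≤z refl → y≰z (subst (_≤ z) (identityˡ y) xy≤z) })
    (λ x≢one → ≤.trans (proj₂ (absorb y x x≢one)) σy≤z)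
    where
    σy≤z : σ y ≤ z
    σy≤z = proj₁ (to (//-undef y z) eq)
    y≰z : ¬ y ≤ z
    y≰z = proj₂ (to (//-undef y z) eq)

  \\-just-≡one : ∀ {x z w} → (x \\ z) ≡ just w → (w ≡ one) ⇔ (x ≤ z)
  \\-just-≡one {x} {z} {w} eq = mk⇔
    (λ w≡one → subst (_≤ z) (identityʳ x) (from (resˡ x one z w eq) (≤-≡one w≡one)))
    (λ x≤z → one≤⇒≡one (to (resˡ x one z w eq) (subst (_≤ z) (sym (identityʳ x)) x≤z)))

  //-just-≡one : ∀ {x z w} → (z // x) ≡ just w → (w ≡ one) ⇔ (x ≤ z)
  //-just-≡one {x} {z} {w} eq = mk⇔
    (λ w≡one → subst (_≤ z) (identityˡ x) (from (resʳ one x z w eq) (≤-≡one w≡one)))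
    (λ x≤z → one≤⇒≡one (to (resʳ one x z w eq) (subst (_≤ z) (sym (identityˡ x)) x≤z)))

  \\-identityˡ : ∀ z → (one \\ z) ≡ just z
  \\-identityˡ z with one \\ z in eq
  ... | nothing = ⊥-elim (proj₂ undef (subst (_≤ z) σ-one (proj₁ undef)))
    where
    undef : (σ one ≤ z) × ¬ (one ≤ z)
    undef = to (\\-undef one z) eq
  ... | just w = cong just (≤.antisym
    (subst (_≤ z) (identityˡ w) (from (resˡ one w z w eq) ≤.refl))
    (to (resˡ one z z w eq) (subst (_≤ z) (sym (identityˡ z)) ≤.refl)))

  //-identityʳ : ∀ z → (z // one) ≡ just z
  //-identityʳ z with z // one in eq
  ... | nothing = ⊥-elim (proj₂ undef (subst (_≤ z) σ-one (proj₁ undef)))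
    where
    undef : (σ one ≤ z) × ¬ (one ≤ z)
    undef = to (//-undef one z) eq
  ... | just w = cong just (≤.antisym
    (subst (_≤ z) (identityʳ w) (from (resʳ w one z w eq) ≤.refl))
    (to (resʳ z one z w eq) (subst (_≤ z) (sym (identityʳ z)) ≤.refl)))

module Construction {ℓ} (em : ExcludedMiddle ℓ) (T : LowerCompatibleTriple ℓ) where
  open LowerCompatibleTriple T
  open LowerCompatibleTripleProperties T
  private module ≤ = IsPartialOrder isPartialOrder

  one? : ∀ x → Dec (x ≡ one)
  one? x = em

  σ-·ˡ : ∀ x {y} → y ≢ one → (x · σ y) ≡ σ (x · y)
  σ-·ˡ x {y} y≢one with one? x
  ... | yes refl = trans (identityˡ (σ y)) (cong σ (sym (identityˡ y)))
  ... | no x≢one = proj₁ (σ-linear x y x≢one y≢one)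

  σ-·ʳ : ∀ {x} y → x ≢ one → σ (x · y) ≡ (σ x · y)
  σ-·ʳ {x} y x≢one with one? y
  ... | yes refl = trans (cong σ (identityʳ x)) (sym (identityʳ (σ x)))
  ... | no y≢one = proj₂ (σ-linear x y x≢one y≢one)

  \\-just-σ≤⇒≤ : ∀ {x z w} → (x \\ z) ≡ just w → σ x ≤ z → x ≤ z
  \\-just-σ≤⇒≤ {x} {z} eq σx≤z with em {P = x ≤ z}
  ... | yes x≤z = x≤z
  ... | no x≰z with trans (sym eq) (from (\\-undef x z) (σx≤z , x≰z))
  ...   | ()

  //-just-σ≤⇒≤ : ∀ {x z w} → (z // x) ≡ just w → σ x ≤ z → x ≤ z
  //-just-σ≤⇒≤ {x} {z} eq σx≤z with em {P = x ≤ z}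
  ... | yes x≤z = x≤z
  ... | no x≰z with trans (sym eq) (from (//-undef x z) (σx≤z , x≰z))
  ...   | ()

  B : Set ℓ
  B = Bcar T

  pattern f = inj₂ tt

  1ᴮ : B
  1ᴮ = inj₁ one

  G : B → Set ℓ
  G = Gset T

  meet-f : K → B
  meet-f x with one? x
  ... | yes _ = f
  ... | no _ = inj₁ x

  join-f : K → B
  join-f x with one? x
  ... | yes _ = 1ᴮ
  ... | no _ = f

  mul-f : K → B
  mul-f x with one? x
  ... | yes _ = f
  ... | no _ = inj₁ (σ x)

  div-f : K → B
  div-f x with one? x
  ... | yes _ = f
  ... | no _ = 1ᴮ

  -- K records a join of two elements ≠ 1 that is f in B as the value 1.
  joinK : K → K → B
  joinK x y with one? (x ∨ y) | em {P = x ≡ one ⊎ y ≡ one}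
  ... | no _  | _ = inj₁ (x ∨ y)
  ... | yes _ | yes _ = 1ᴮ
  ... | yes _ | no _ = f

  fromDiv : Maybe K → B
  fromDiv (just w) = inj₁ w
  fromDiv nothing = f

  infixl 7 _⊗_
  infixr 6 _⊓_
  infixr 5 _⊔_

  _⊓_ : Op₂ B
  inj₁ x ⊓ inj₁ y = inj₁ (x ∧ y)
  inj₁ x ⊓ f = meet-f x
  f ⊓ inj₁ y = meet-f y
  f ⊓ f = f

  _⊔_ : Op₂ B
  inj₁ x ⊔ inj₁ y = joinK x y
  inj₁ x ⊔ f = join-f x
  f ⊔ inj₁ y = join-f y
  f ⊔ f = f

  _⊗_ : Op₂ B
  inj₁ x ⊗ inj₁ y = inj₁ (x · y)
  inj₁ x ⊗ f = mul-f x
  f ⊗ inj₁ y = mul-f y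
  f ⊗ f = f

  _⇒_ : Op₂ B
  inj₁ x ⇒ inj₁ z = fromDiv (x \\ z)
  inj₁ x ⇒ f = div-f x
  f ⇒ inj₁ z = inj₁ (γ z)
  f ⇒ f = 1ᴮ

  _⇐_ : Op₂ B
  inj₁ z ⇐ inj₁ x = fromDiv (z // x)
  f ⇐ inj₁ x = div-f x
  inj₁ z ⇐ f = inj₁ (γ z)
  f ⇐ f = 1ᴮ

  infix 4 _⊑_
  data _⊑_ : B → B → Set ℓ where
    K⊑K : ∀ {x y} → x ≤ y → inj₁ x ⊑ inj₁ y
    K⊑f : ∀ {x} → x ≢ one → inj₁ x ⊑ f
    f⊑K : ∀ {y} → y ≡ one → f ⊑ inj₁ y
    f⊑f : f ⊑ f

  K⊑K⇔ : ∀ {x y} → (inj₁ x ⊑ inj₁ y) ⇔ (x ≤ y)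
  K⊑K⇔ = mk⇔ (λ { (K⊑K x≤y) → x≤y }) K⊑K

  K⊑f⇔ : ∀ {x} → (inj₁ x ⊑ f) ⇔ (x ≢ one)
  K⊑f⇔ = mk⇔ (λ { (K⊑f x≢one) → x≢one }) K⊑f

  f⊑K⇔ : ∀ {y} → (f ⊑ inj₁ y) ⇔ (y ≡ one)
  f⊑K⇔ = mk⇔ (λ { (f⊑K y≡one) → y≡one }) f⊑K

  ⊑-refl : ∀ {a} → a ⊑ a
  ⊑-refl {inj₁ x} = K⊑K ≤.refl
  ⊑-refl {f} = f⊑f

  ⊑-trans : ∀ {a b c} → a ⊑ b → b ⊑ c → a ⊑ c
  ⊑-trans (K⊑K p) (K⊑K q) = K⊑K (≤.trans p q)
  ⊑-trans (K⊑K p) (K⊑f q) = K⊑f (λ x≡one → q (≡one-≤⇒≡one x≡one p))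
  ⊑-trans (K⊑f _) (f⊑K q) = K⊑K (≤-≡one q)
  ⊑-trans (K⊑f p) f⊑f = K⊑f p
  ⊑-trans (f⊑K p) (K⊑K q) = f⊑K (≡one-≤⇒≡one p q)
  ⊑-trans (f⊑K p) (K⊑f q) = ⊥-elim (q p)
  ⊑-trans f⊑f q = q

  ⊑-antisym : ∀ {a b} → a ⊑ b → b ⊑ a → a ≡ b
  ⊑-antisym (K⊑K p) (K⊑K q) = cong inj₁ (≤.antisym p q)
  ⊑-antisym (K⊑f p) (f⊑K q) = ⊥-elim (p q)
  ⊑-antisym (f⊑K p) (K⊑f q) = ⊥-elim (q p)
  ⊑-antisym f⊑f f⊑f = refl

  ⊑-isPartialOrder : IsPartialOrder _≡_ _⊑_
  ⊑-isPartialOrder = record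
    { isPreorder = record
      { isEquivalence = isEquivalence
      ; reflexive = λ { refl → ⊑-refl }
      ; trans = ⊑-trans }
    ; antisym = ⊑-antisym }

  ⊑-top : ∀ a → a ⊑ 1ᴮ
  ⊑-top (inj₁ x) = K⊑K (integral x)
  ⊑-top f = f⊑K refl

  meet-f⊑K : ∀ x → meet-f x ⊑ inj₁ x
  meet-f⊑K x with one? x
  ... | yes x≡one = f⊑K x≡one
  ... | no _ = ⊑-refl

  meet-f⊑f : ∀ x → meet-f x ⊑ f
  meet-f⊑f x with one? x
  ... | yes _ = f⊑f
  ... | no x≢one = K⊑f x≢one

  meet-f-greatest : ∀ x {c} → c ⊑ inj₁ x → c ⊑ f → c ⊑ meet-f x
  meet-f-greatest x c⊑x c⊑f with one? x
  ... | yes _ = c⊑f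
  ... | no _ = c⊑x

  K⊑join-f : ∀ x → inj₁ x ⊑ join-f x
  K⊑join-f x with one? x
  ... | yes _ = ⊑-top (inj₁ x)
  ... | no x≢one = K⊑f x≢one

  f⊑join-f : ∀ x → f ⊑ join-f x
  f⊑join-f x with one? x
  ... | yes _ = f⊑K refl
  ... | no _ = f⊑f

  join-f-least : ∀ x {c} → inj₁ x ⊑ c → f ⊑ c → join-f x ⊑ c
  join-f-least x x⊑c f⊑c with one? x
  join-f-least x (K⊑K _) (f⊑K c≡one) | yes _ = K⊑K (≤-≡one c≡one)
  join-f-least x (K⊑f x≢one) f⊑c | yes x≡one = ⊥-elim (x≢one x≡one)
  ... | no _ = f⊑c

  K⊑joinKˡ : ∀ x y → inj₁ x ⊑ joinK x y
  K⊑joinKˡ x y with one? (x ∨ y) | em {P = x ≡ one ⊎ y ≡ one}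
  ... | no _  | _ = K⊑K (∨-upperˡ x y)
  ... | yes _ | yes _ = ⊑-top (inj₁ x)
  ... | yes _ | no neither = K⊑f (neither ∘ inj₁)

  K⊑joinKʳ : ∀ x y → inj₁ y ⊑ joinK x y
  K⊑joinKʳ x y with one? (x ∨ y) | em {P = x ≡ one ⊎ y ≡ one}
  ... | no _  | _ = K⊑K (∨-upperʳ x y)
  ... | yes _ | yes _ = ⊑-top (inj₁ y)
  ... | yes _ | no neither = K⊑f (neither ∘ inj₂)

  joinK-least : ∀ x y {c} → inj₁ x ⊑ c → inj₁ y ⊑ c → joinK x y ⊑ c
  joinK-least x y x⊑c y⊑c with one? (x ∨ y) | em {P = x ≡ one ⊎ y ≡ one} | x⊑c | y⊑c
  ... | no _ | _ | K⊑K p | K⊑K q = K⊑K (∨-least p q)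
  ... | no x∨y≢one | _ | K⊑f _ | K⊑f _ = K⊑f x∨y≢one
  ... | yes x∨y≡one | _ | K⊑K p | K⊑K q =
    ⊑-trans (⊑-top _) (K⊑K (subst (_≤ _) x∨y≡one (∨-least p q)))
  ... | yes _ | yes (inj₁ x≡one) | K⊑f x≢one | _ = ⊥-elim (x≢one x≡one)
  ... | yes _ | yes (inj₂ y≡one) | _ | K⊑f y≢one = ⊥-elim (y≢one y≡one)
  ... | yes _ | no _ | K⊑f _ | K⊑f _ = f⊑f

  ⊓-lowerˡ : ∀ a b → a ⊓ b ⊑ a
  ⊓-lowerˡ (inj₁ x) (inj₁ y) = K⊑K (∧-lowerˡ x y)
  ⊓-lowerˡ (inj₁ x) f = meet-f⊑K x
  ⊓-lowerˡ f (inj₁ y) = meet-f⊑f y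
  ⊓-lowerˡ f f = f⊑f

  ⊓-lowerʳ : ∀ a b → a ⊓ b ⊑ b
  ⊓-lowerʳ (inj₁ x) (inj₁ y) = K⊑K (∧-lowerʳ x y)
  ⊓-lowerʳ (inj₁ x) f = meet-f⊑f x
  ⊓-lowerʳ f (inj₁ y) = meet-f⊑K y
  ⊓-lowerʳ f f = f⊑f

  ⊓-greatest : ∀ a b {c} → c ⊑ a → c ⊑ b → c ⊑ a ⊓ b
  ⊓-greatest (inj₁ x) (inj₁ y) (K⊑K p) (K⊑K q) = K⊑K (∧-greatest p q)
  ⊓-greatest (inj₁ x) (inj₁ y) (f⊑K p) (f⊑K q) =
    f⊑K (one≤⇒≡one (∧-greatest (≤-≡one p) (≤-≡one q)))
  ⊓-greatest (inj₁ x) f c⊑x c⊑f = meet-f-greatest x c⊑x c⊑f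
  ⊓-greatest f (inj₁ y) c⊑f c⊑y = meet-f-greatest y c⊑y c⊑f
  ⊓-greatest f f _ c⊑f = c⊑f

  ⊔-upperˡ : ∀ a b → a ⊑ a ⊔ b
  ⊔-upperˡ (inj₁ x) (inj₁ y) = K⊑joinKˡ x y
  ⊔-upperˡ (inj₁ x) f = K⊑join-f x
  ⊔-upperˡ f (inj₁ y) = f⊑join-f y
  ⊔-upperˡ f f = f⊑f

  ⊔-upperʳ : ∀ a b → b ⊑ a ⊔ b
  ⊔-upperʳ (inj₁ x) (inj₁ y) = K⊑joinKʳ x y
  ⊔-upperʳ (inj₁ x) f = f⊑join-f x
  ⊔-upperʳ f (inj₁ y) = K⊑join-f y
  ⊔-upperʳ f f = f⊑f

  ⊔-least : ∀ a b {c} → a ⊑ c → b ⊑ c → a ⊔ b ⊑ c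
  ⊔-least (inj₁ x) (inj₁ y) x⊑c y⊑c = joinK-least x y x⊑c y⊑c
  ⊔-least (inj₁ x) f x⊑c f⊑c = join-f-least x x⊑c f⊑c
  ⊔-least f (inj₁ y) f⊑c y⊑c = join-f-least y y⊑c f⊑c
  ⊔-least f f f⊑c _ = f⊑c

  mul-f-one : mul-f one ≡ f
  mul-f-one with one? one
  ... | yes _ = refl
  ... | no one≢one = ⊥-elim (one≢one refl)

  mul-f-≢one : ∀ {x} → x ≢ one → mul-f x ≡ inj₁ (σ x)
  mul-f-≢one {x} x≢one with one? x
  ... | yes x≡one = ⊥-elim (x≢one x≡one)
  ... | no _ = refl

  f-central : ∀ a → f ⊗ a ≡ a ⊗ f
  f-central (inj₁ x) = refl
  f-central f = refl

  f⊗mul-f : ∀ x → f ⊗ mul-f x ≡ mul-f x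
  f⊗mul-f x with one? x
  ... | yes _ = refl
  ... | no x≢one = trans (mul-f-≢one (σ-≢one x≢one)) (cong inj₁ (σ-idem x))

  mul-f-·ˡ : ∀ x y → mul-f (x · y) ≡ inj₁ x ⊗ mul-f y
  mul-f-·ˡ x y with one? y
  ... | yes refl = cong mul-f (identityʳ x)
  ... | no y≢one = trans (mul-f-≢one (y≢one ∘ x·y≡one⇒y≡one)) (cong inj₁ (sym (σ-·ˡ x y≢one)))

  mul-f-·ʳ : ∀ x y → mul-f (x · y) ≡ mul-f x ⊗ inj₁ y
  mul-f-·ʳ x y with one? x
  ... | yes refl = cong mul-f (identityˡ y)
  ... | no x≢one = trans (mul-f-≢one (x≢one ∘ x·y≡one⇒x≡one)) (cong inj₁ (σ-·ʳ y x≢one))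

  ⊗-identityˡ : ∀ a → 1ᴮ ⊗ a ≡ a
  ⊗-identityˡ (inj₁ y) = cong inj₁ (identityˡ y)
  ⊗-identityˡ f = mul-f-one

  ⊗-identityʳ : ∀ a → a ⊗ 1ᴮ ≡ a
  ⊗-identityʳ (inj₁ y) = cong inj₁ (identityʳ y)
  ⊗-identityʳ f = mul-f-one

  ⊗-assoc : ∀ a b c → (a ⊗ b) ⊗ c ≡ a ⊗ (b ⊗ c)
  ⊗-assoc (inj₁ x) (inj₁ y) (inj₁ z) = cong inj₁ (assoc x y z)
  ⊗-assoc (inj₁ x) (inj₁ y) f = mul-f-·ˡ x y
  ⊗-assoc (inj₁ x) f (inj₁ z) = trans (sym (mul-f-·ʳ x z)) (mul-f-·ˡ x z)
  ⊗-assoc (inj₁ x) f f = trans (sym (f-central (mul-f x))) (f⊗mul-f x)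
  ⊗-assoc f (inj₁ y) (inj₁ z) = sym (mul-f-·ʳ y z)
  ⊗-assoc f (inj₁ y) f = sym (f-central (mul-f y))
  ⊗-assoc f f (inj₁ z) = sym (f⊗mul-f z)
  ⊗-assoc f f f = refl

  ⊗-isMonoid : IsMonoid _≡_ _⊗_ 1ᴮ
  ⊗-isMonoid = record
    { isSemigroup = record
      { isMagma = record { isEquivalence = isEquivalence ; ∙-cong = cong₂ _⊗_ }
      ; assoc = ⊗-assoc }
    ; identity = ⊗-identityˡ , ⊗-identityʳ }

  mul-f⊑f : ∀ x → mul-f x ⊑ f
  mul-f⊑f x with one? x
  ... | yes _ = f⊑f
  ... | no x≢one = K⊑f (σ-≢one x≢one)

  f⊑div-f : ∀ x → f ⊑ div-f x
  f⊑div-f x with one? x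
  ... | yes _ = f⊑f
  ... | no _ = f⊑K refl

  mul-f⊑K⇔ : ∀ x {z} → (mul-f x ⊑ inj₁ z) ⇔ (σ x ≤ z)
  mul-f⊑K⇔ x {z} with one? x
  ... | yes refl = mk⇔ (λ { (f⊑K z≡one) → ≤-≡one z≡one })
                       (λ σone≤z → f⊑K (one≤⇒≡one (subst (_≤ z) σ-one σone≤z)))
  ... | no _ = K⊑K⇔

  mul-f⊑K⇔K⊑γ : ∀ x z → (mul-f x ⊑ inj₁ z) ⇔ (inj₁ x ⊑ inj₁ (γ z))
  mul-f⊑K⇔K⊑γ x z = begin
    mul-f x ⊑ inj₁ z      ∼⟨ mul-f⊑K⇔ x ⟩
    σ x ≤ z               ∼⟨ galois x z ⟩
    x ≤ γ z               ∼⟨ ⇔-sym K⊑K⇔ ⟩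
    inj₁ x ⊑ inj₁ (γ z)   ∎
    where open EquationalReasoning

  f⊑K⇔f⊑γ : ∀ z → (f ⊑ inj₁ z) ⇔ (f ⊑ inj₁ (γ z))
  f⊑K⇔f⊑γ z = begin
    f ⊑ inj₁ z       ∼⟨ f⊑K⇔ ⟩
    z ≡ one          ∼⟨ ⇔-sym γ≡one⇔≡one ⟩
    γ z ≡ one        ∼⟨ ⇔-sym f⊑K⇔ ⟩
    f ⊑ inj₁ (γ z)   ∎
    where open EquationalReasoning

  f⊑fromDiv-\\⇔ : ∀ x z → (f ⊑ fromDiv (x \\ z)) ⇔ (σ x ≤ z)
  f⊑fromDiv-\\⇔ x z with x \\ z in eq
  ... | nothing = mk⇔ (λ _ → proj₁ (to (\\-undef x z) eq)) (λ _ → f⊑f)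
  ... | just w = begin
    f ⊑ inj₁ w   ∼⟨ f⊑K⇔ ⟩
    w ≡ one      ∼⟨ \\-just-≡one eq ⟩
    x ≤ z        ∼⟨ mk⇔ (≤.trans (σ-deflationary x)) (\\-just-σ≤⇒≤ eq) ⟩
    σ x ≤ z      ∎
    where open EquationalReasoning

  f⊑fromDiv-//⇔ : ∀ x z → (f ⊑ fromDiv (z // x)) ⇔ (σ x ≤ z)
  f⊑fromDiv-//⇔ x z with z // x in eq
  ... | nothing = mk⇔ (λ _ → proj₁ (to (//-undef x z) eq)) (λ _ → f⊑f)
  ... | just w = begin
    f ⊑ inj₁ w   ∼⟨ f⊑K⇔ ⟩
    w ≡ one      ∼⟨ //-just-≡one eq ⟩
    x ≤ z        ∼⟨ mk⇔ (≤.trans (σ-deflationary x)) (//-just-σ≤⇒≤ eq) ⟩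
    σ x ≤ z      ∎
    where open EquationalReasoning

  K⊗K⊑K⇔-\\ : ∀ x y z → (inj₁ (x · y) ⊑ inj₁ z) ⇔ (inj₁ y ⊑ fromDiv (x \\ z))
  K⊗K⊑K⇔-\\ x y z with x \\ z in eq
  ... | just w = begin
    inj₁ (x · y) ⊑ inj₁ z   ∼⟨ K⊑K⇔ ⟩
    (x · y) ≤ z             ∼⟨ resˡ x y z w eq ⟩
    y ≤ w                   ∼⟨ ⇔-sym K⊑K⇔ ⟩
    inj₁ y ⊑ inj₁ w         ∎
    where open EquationalReasoning
  ... | nothing = begin
    inj₁ (x · y) ⊑ inj₁ z   ∼⟨ K⊑K⇔ ⟩
    (x · y) ≤ z             ∼⟨ \\-undefined eq ⟩
    y ≢ one                 ∼⟨ ⇔-sym K⊑f⇔ ⟩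
    inj₁ y ⊑ f              ∎
    where open EquationalReasoning

  K⊗K⊑K⇔-// : ∀ x y z → (inj₁ (x · y) ⊑ inj₁ z) ⇔ (inj₁ x ⊑ fromDiv (z // y))
  K⊗K⊑K⇔-// x y z with z // y in eq
  ... | just w = begin
    inj₁ (x · y) ⊑ inj₁ z   ∼⟨ K⊑K⇔ ⟩
    (x · y) ≤ z             ∼⟨ resʳ x y z w eq ⟩
    x ≤ w                   ∼⟨ ⇔-sym K⊑K⇔ ⟩
    inj₁ x ⊑ inj₁ w         ∎
    where open EquationalReasoning
  ... | nothing = begin
    inj₁ (x · y) ⊑ inj₁ z   ∼⟨ K⊑K⇔ ⟩
    (x · y) ≤ z             ∼⟨ //-undefined eq ⟩
    x ≢ one                 ∼⟨ ⇔-sym K⊑f⇔ ⟩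
    inj₁ x ⊑ f              ∎
    where open EquationalReasoning

  K⊗K⊑f⇔-\\ : ∀ x y → (inj₁ (x · y) ⊑ f) ⇔ (inj₁ y ⊑ div-f x)
  K⊗K⊑f⇔-\\ x y with one? x
  ... | yes refl rewrite identityˡ y = ⇔-id _
  ... | no x≢one = mk⇔ (λ _ → ⊑-top (inj₁ y)) (λ _ → K⊑f (x≢one ∘ x·y≡one⇒x≡one))

  K⊗K⊑f⇔-// : ∀ x y → (inj₁ (x · y) ⊑ f) ⇔ (inj₁ x ⊑ div-f y)
  K⊗K⊑f⇔-// x y with one? y
  ... | yes refl rewrite identityʳ x = ⇔-id _
  ... | no y≢one = mk⇔ (λ _ → ⊑-top (inj₁ x)) (λ _ → K⊑f (y≢one ∘ x·y≡one⇒y≡one))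

  ⇒-residual : ∀ a b c → (a ⊗ b ⊑ c) ⇔ (b ⊑ a ⇒ c)
  ⇒-residual (inj₁ x) (inj₁ y) (inj₁ z) = K⊗K⊑K⇔-\\ x y z
  ⇒-residual (inj₁ x) (inj₁ y) f = K⊗K⊑f⇔-\\ x y
  ⇒-residual (inj₁ x) f (inj₁ z) = ⇔-sym (f⊑fromDiv-\\⇔ x z) ⇔-∘ mul-f⊑K⇔ x
  ⇒-residual (inj₁ x) f f = mk⇔ (λ _ → f⊑div-f x) (λ _ → mul-f⊑f x)
  ⇒-residual f (inj₁ y) (inj₁ z) = mul-f⊑K⇔K⊑γ y z
  ⇒-residual f (inj₁ y) f = mk⇔ (λ _ → ⊑-top (inj₁ y)) (λ _ → mul-f⊑f y)
  ⇒-residual f f (inj₁ z) = f⊑K⇔f⊑γ z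
  ⇒-residual f f f = mk⇔ (λ _ → ⊑-top f) (λ _ → f⊑f)

  ⇐-residual : ∀ a b c → (a ⊗ b ⊑ c) ⇔ (a ⊑ c ⇐ b)
  ⇐-residual (inj₁ x) (inj₁ y) (inj₁ z) = K⊗K⊑K⇔-// x y z
  ⇐-residual (inj₁ x) (inj₁ y) f = K⊗K⊑f⇔-// x y
  ⇐-residual f (inj₁ y) (inj₁ z) = ⇔-sym (f⊑fromDiv-//⇔ y z) ⇔-∘ mul-f⊑K⇔ y
  ⇐-residual f (inj₁ y) f = mk⇔ (λ _ → f⊑div-f y) (λ _ → mul-f⊑f y)
  ⇐-residual (inj₁ x) f (inj₁ z) = mul-f⊑K⇔K⊑γ x z
  ⇐-residual (inj₁ x) f f = mk⇔ (λ _ → ⊑-top (inj₁ x)) (λ _ → mul-f⊑f x)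
  ⇐-residual f f (inj₁ z) = f⊑K⇔f⊑γ z
  ⇐-residual f f f = mk⇔ (λ _ → ⊑-top f) (λ _ → f⊑f)

  ⊔-supremum : Supremum _⊑_ _⊔_
  ⊔-supremum a b = ⊔-upperˡ a b , ⊔-upperʳ a b , λ _ → ⊔-least a b

  ⊓-infimum : Infimum _⊑_ _⊓_
  ⊓-infimum a b = ⊓-lowerˡ a b , ⊓-lowerʳ a b , λ _ → ⊓-greatest a b

  open ResiduatedPoset ⊑-isPartialOrder ⊔-supremum ⊓-infimum
    ⊗-isMonoid ⇒-residual ⇐-residual ⊑-top
    public using (irl; a⊑b⇒a⊓b≡a; a⊓b≡a⇒a⊑b; ⊗-monoˡ; ⊗-monoʳ)

  joinK-≢one : ∀ x y → (x ∨ y) ≢ one → inj₁ (x ∨ y) ≡ joinK x y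
  joinK-≢one x y x∨y≢one with one? (x ∨ y) | em {P = x ≡ one ⊎ y ≡ one}
  ... | no _ | _ = refl
  ... | yes x∨y≡one | _ = ⊥-elim (x∨y≢one x∨y≡one)

  fromDiv-just : ∀ {m z} → m ≡ just z → inj₁ z ≡ fromDiv m
  fromDiv-just refl = refl

  extendsK : ExtendsKminus1 T irl
  extendsK x y _ _ = refl , refl , joinK-≢one x y
    , (λ _ eq _ → fromDiv-just eq) , (λ _ eq _ → fromDiv-just eq)

  meet-f-one : meet-f one ≡ f
  meet-f-one with one? one
  ... | yes _ = refl
  ... | no one≢one = ⊥-elim (one≢one refl)

  join-f-one : join-f one ≡ 1ᴮ
  join-f-one with one? one
  ... | yes _ = refl
  ... | no one≢one = ⊥-elim (one≢one refl)

  div-f-one : div-f one ≡ f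
  div-f-one with one? one
  ... | yes _ = refl
  ... | no one≢one = ⊥-elim (one≢one refl)

  joinK-one : joinK one one ≡ 1ᴮ
  joinK-one with one? (one ∨ one) | em {P = one ≡ one ⊎ one ≡ one}
  ... | no one∨one≢one | _ = ⊥-elim (one∨one≢one (one≤⇒≡one (∨-upperˡ one one)))
  ... | yes _ | yes _ = refl
  ... | yes _ | no neither = ⊥-elim (neither (inj₁ refl))

  extendsG : ExtendsG T irl
  extendsG 1₀ 1₀ = cong inj₁ (sym (one≤⇒≡one (∧-greatest ≤.refl ≤.refl)))
    , sym joinK-one , cong inj₁ (sym (identityˡ one))
    , cong fromDiv (sym (\\-identityˡ one)) , cong fromDiv (sym (//-identityʳ one))
  extendsG 1₀ f₀ = sym meet-f-one , sym join-f-one , sym mul-f-one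
    , sym div-f-one , sym div-f-one
  extendsG f₀ 1₀ = sym meet-f-one , sym join-f-one , sym mul-f-one
    , cong inj₁ (sym γ-one) , cong inj₁ (sym γ-one)
  extendsG f₀ f₀ = refl , refl , refl , refl , refl

  G⇔f⊑ : ∀ {a} → G a ⇔ (f ⊑ a)
  G⇔f⊑ = mk⇔ (λ { (inj₁ refl) → f⊑f ; (inj₂ refl) → f⊑K refl })
             (λ { f⊑f → inj₁ refl ; (f⊑K refl) → inj₂ refl })

  ¬G⇒≢one : ∀ {x} → ¬ G (inj₁ x) → x ≢ one
  ¬G⇒≢one ¬Gx refl = ¬Gx (inj₂ refl)

  ≢one⇒¬G : ∀ {x} → x ≢ one → ¬ G (inj₁ x)
  ≢one⇒¬G x≢one (inj₂ refl) = x≢one refl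

  G-congruenceFilter : IsCongruenceFilter irl G
  G-congruenceFilter = record
    { nonempty = f , inj₁ refl
    ; upset = λ Ga a≤b → from G⇔f⊑ (⊑-trans (to G⇔f⊑ Ga) (a⊓b≡a⇒a⊑b a≤b))
    ; prod = λ {a} Ga Gb →
        from G⇔f⊑ (⊑-trans (⊗-monoˡ f (to G⇔f⊑ Ga)) (⊗-monoʳ a (to G⇔f⊑ Gb)))
    ; conjˡ = λ {a} b Ga → below-1ᴮ (from G⇔f⊑ (to (⇒-residual b f (a ⊗ b))
        (subst (_⊑ a ⊗ b) (f-central b) (⊗-monoˡ b (to G⇔f⊑ Ga)))))
    ; conjʳ = λ {a} b Ga → below-1ᴮ (from G⇔f⊑ (to (⇐-residual f b (b ⊗ a))
        (subst (_⊑ b ⊗ a) (sym (f-central b)) (⊗-monoʳ b (to G⇔f⊑ Ga)))))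
    }
    where
    below-1ᴮ : ∀ {a} → G a → G (a ⊓ 1ᴮ)
    below-1ᴮ {a} Ga = from G⇔f⊑ (⊓-greatest a 1ᴮ (to G⇔f⊑ Ga) (⊑-top f))

  G-⇒⇔ : ∀ x y → G (inj₁ x ⇒ inj₁ y) ⇔ (σ x ≤ y)
  G-⇒⇔ x y = f⊑fromDiv-\\⇔ x y ⇔-∘ G⇔f⊑

  σ-minOfClass : ∀ b → ¬ G b → Σ B (IsMinOfClass irl G b)
  σ-minOfClass f ¬Gb = ⊥-elim (¬Gb (inj₁ refl))
  σ-minOfClass (inj₁ b) ¬Gb =
    inj₁ (σ b) , (from (G-⇒⇔ (σ b) b) σσb≤b , from (G-⇒⇔ b (σ b)) ≤.refl) , least
    where
    σσb≤b : σ (σ b) ≤ b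
    σσb≤b = subst (_≤ b) (sym (σ-idem b)) (σ-deflationary b)
    least : ∀ a → θ irl G a (inj₁ b) → IRLOn._≤_ irl (inj₁ (σ b)) a
    least (inj₁ x) (_ , Gb⇒x) = a⊑b⇒a⊓b≡a (K⊑K (to (G-⇒⇔ b x) Gb⇒x))
    least f _ = a⊑b⇒a⊓b≡a (K⊑f (σ-≢one (¬G⇒≢one ¬Gb)))

  γ-maxOfClass : ∀ b → ¬ G b → Σ B (IsMaxOfClass irl G b)
  γ-maxOfClass f ¬Gb = ⊥-elim (¬Gb (inj₁ refl))
  γ-maxOfClass (inj₁ b) ¬Gb =
    inj₁ (γ b) , (from (G-⇒⇔ (γ b) b) σγb≤b , from (G-⇒⇔ b (γ b)) σb≤γb) , greatest
    where
    σγb≤b : σ (γ b) ≤ b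
    σγb≤b = from (galois (γ b) b) ≤.refl
    σb≤γb : σ b ≤ γ b
    σb≤γb = ≤.trans (σ-deflationary b) (γ-inflationary b)
    greatest : ∀ a → θ irl G a (inj₁ b) → IRLOn._≤_ irl a (inj₁ (γ b))
    greatest (inj₁ x) (Gx⇒b , _) = a⊑b⇒a⊓b≡a (K⊑K (to (galois x b) (to (G-⇒⇔ x b) Gx⇒b)))
    greatest f (Gf⇒b , _) =
      ⊥-elim (¬G⇒≢one ¬Gb (to γ≡one⇔≡one (to f⊑K⇔ (to G⇔f⊑ Gf⇒b))))

  G-compatible : Compatible irl G
  G-compatible = record
    { strictlyAbove = strictlyAbove
    ; minClass = σ-minOfClass
    ; maxClass = γ-maxOfClass
    ; closedˡ = λ { (inj₁ b) ¬Gb (inj₁ c) ¬Gc →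
                      inj₁ (b · c) , ≢one⇒¬G (¬G⇒≢one ¬Gb ∘ x·y≡one⇒x≡one)
                      , cong inj₁ (σ-·ˡ b (¬G⇒≢one ¬Gc))
                  ; f ¬Gb _ _ → ⊥-elim (¬Gb (inj₁ refl))
                  ; (inj₁ b) _ f ¬Gc → ⊥-elim (¬Gc (inj₁ refl)) }
    ; closedʳ = λ { (inj₁ b) ¬Gb (inj₁ c) ¬Gc →
                      inj₁ (c · b) , ≢one⇒¬G (¬G⇒≢one ¬Gc ∘ x·y≡one⇒x≡one)
                      , cong inj₁ (sym (σ-·ʳ b (¬G⇒≢one ¬Gc)))
                  ; f ¬Gb _ _ → ⊥-elim (¬Gb (inj₁ refl))
                  ; (inj₁ b) _ f ¬Gc → ⊥-elim (¬Gc (inj₁ refl)) }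
    }
    where
    strictlyAbove : ∀ {a b} → G a → ¬ G b → IRLOn._≤_ irl b a × b ≢ a
    strictlyAbove Ga ¬Gb = a⊑b⇒a⊓b≡a (⊑-trans (¬G⇒⊑f ¬Gb) (to G⇔f⊑ Ga))
                         , λ { refl → ¬Gb Ga }
      where
      ¬G⇒⊑f : ∀ {b} → ¬ G b → b ⊑ f
      ¬G⇒⊑f {inj₁ x} ¬Gb = K⊑f (¬G⇒≢one ¬Gb)
      ¬G⇒⊑f {f} ¬Gb = ⊥-elim (¬Gb (inj₁ refl))

  joinK-triple : ∀ x y →
      (G (joinK x y) × joinK x y ≢ 1ᴮ → (x ∨ y) ≡ one)
    × (¬ (G (joinK x y) × joinK x y ≢ 1ᴮ) → inj₁ (x ∨ y) ≡ joinK x y)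
  joinK-triple x y with one? (x ∨ y) | em {P = x ≡ one ⊎ y ≡ one}
  ... | no _ | _ = (λ { (inj₂ refl , ≢1ᴮ) → ⊥-elim (≢1ᴮ refl) }) , λ _ → refl
  ... | yes x∨y≡one | yes _ = (λ _ → x∨y≡one) , λ _ → cong inj₁ x∨y≡one
  ... | yes x∨y≡one | no _ = (λ _ → x∨y≡one) , λ notf → ⊥-elim (notf (inj₁ refl , λ ()))

  fromDiv-triple : ∀ m →
      ((m ≡ nothing) ⇔ (G (fromDiv m) × fromDiv m ≢ 1ᴮ))
    × (∀ z → m ≡ just z → inj₁ z ≡ fromDiv m)
  fromDiv-triple nothing = mk⇔ (λ _ → inj₁ refl , λ ()) (λ _ → refl) , λ _ ()
  fromDiv-triple (just w) =
    mk⇔ (λ ()) (λ { (inj₂ refl , ≢1ᴮ) → ⊥-elim (≢1ᴮ refl) }) , λ _ → fromDiv-just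

  compatibleTriple : CompatibleTripleIs T irl G-compatible
  compatibleTriple = refl
    , (λ x y → mk⇔ (a⊑b⇒a⊓b≡a ∘ K⊑K) (to K⊑K⇔ ∘ a⊓b≡a⇒a⊑b))
    , (λ x y → refl) , (λ x y → refl)
    , joinK-triple
    , (λ x y → fromDiv-triple (x \\ y))
    , (λ x y → fromDiv-triple (y // x))
    , (λ x ¬Gx → refl , refl)
    , σ-one , γ-one

lemma2p6 : ∀ {ℓ} → ExcludedMiddle ℓ → (T : LowerCompatibleTriple ℓ) →
    Σ (IRLOn (Bcar T)) λ B →
        (IRLOn.one B ≡ inj₁ (LowerCompatibleTriple.one T))
      × ExtendsKminus1 T B
      × ExtendsG T B
      × IsCongruenceFilter B (Gset T)
      × Σ (Compatible B (Gset T)) λ c → CompatibleTripleIs T B c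
lemma2p6 em T =
  irl , refl , extendsK , extendsG , G-congruenceFilter , G-compatible , compatibleTriple
  where open Construction em T
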